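{- Let $C : \mathsf{Form} \to \mathsf{Prop}$ be any predicate, $\mathsf{Code}$ any type and $\mathsf{eval} : \mathsf{Code} \to \mathsf{Code} \to \mathsf{Form}$ any function. Assume: (i) for every function $f : \mathsf{Code} \to \mathsf{Form}$ there exists $c \in \mathsf{Code}$ such that for all $x \in \mathsf{Code}$, $\mathsf{eval}(c,x) \simeq_C f(x)$; (ii) for all formulas $A,B$, if $C(A \to B)$ and $C(A)$ then $C(B)$; (iii) $C(\bot)$ does not hold; (iv) (decision) there exists a function $d : \mathsf{Form} \to \{\mathsf{tt},\mathsf{ff}\}$ such that for every formula $A$, $d(A) = \mathsf{tt}$ implies $C(A)$, and $d(A) = \mathsf{ff}$ implies $C(\neg A)$. Then a contradiction follows; i.e., (i)–(iv) cannot hold jointly.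
   Context: $\mathsf{Form}$ is the type of closed formulas generated by $A,B ::= \bot \mid A \to B$; $\neg A$ abbreviates $A \to \bot$. For a predicate $C$ on $\mathsf{Form}$, $A \simeq_C B$ means $C(A \to B) \land C(B \to A)$. -}

module Defs where

open import Data.Product using (_×_)

data Form : Set where
  ⊥f  : Form
  _⇒_ : Form → Form → Form

infixr 5 _⇒_

¬f_ : Form → Form
¬f A = A ⇒ ⊥f

_≃[_]_ : Form → (Form → Set) → Form → Set
A ≃[ C ] B = C (A ⇒ B) × C (B ⇒ A)

{-# OPTIONS --safe #-}
module Submission where

open import Defs
open import Data.Bool using (Bool; true; false)
open import Data.Empty using (⊥)
open import Data.Product using (Σ; _×_; _,_; proj₁; proj₂)
open import Data.Sum using (_⊎_; inj₁; inj₂)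
open import Relation.Binary.PropositionalEquality using (_≡_)

diagonal-lemma : (C : Form → Set) (Code : Set) (eval : Code → Code → Form) →
  ((f : Code → Form) → Σ Code (λ c → (x : Code) → eval c x ≃[ C ] f x)) →
  (F : Form → Form) → Σ Form (λ G → G ≃[ C ] F G)
diagonal-lemma C Code eval represent F with represent (λ x → F (eval x x))
... | c , c-represents = eval c c , c-represents c

decider⇒complete : (C : Form → Set) →
  Σ (Form → Bool) (λ d → (A : Form) → (d A ≡ true → C A) × (d A ≡ false → C (¬f A))) →
  (A : Form) → C A ⊎ C (¬f A)
decider⇒complete C (d , d-sound) A with d A in eq
... | true  = inj₁ (proj₁ (d-sound A) eq)
... | false = inj₂ (proj₂ (d-sound A) eq)

module _ {C : Form → Set}
         (mp : (A B : Form) → C (A ⇒ B) → C A → C B)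
         (consistent : C ⊥f → ⊥) where

  not-both : {A : Form} → C A → C (¬f A) → ⊥
  not-both {A} a ¬a = consistent (mp A ⊥f ¬a a)

  liar-undecided : {G : Form} → G ≃[ C ] (¬f G) → C G ⊎ C (¬f G) → ⊥
  liar-undecided {G} (G⇒¬G , _) (inj₁ g)  = not-both g (mp G (¬f G) G⇒¬G g)
  liar-undecided {G} (_ , ¬G⇒G) (inj₂ ¬g) = not-both (mp (¬f G) G ¬G⇒G ¬g) ¬g

theorem3p12 : (C : Form → Set) (Code : Set) (eval : Code → Code → Form) →
    ((f : Code → Form) → Σ Code (λ c → (x : Code) → eval c x ≃[ C ] f x)) →
    ((A B : Form) → C (A ⇒ B) → C A → C B) →
    (C ⊥f → ⊥) →
    (Σ (Form → Bool) (λ d → (A : Form) → (d A ≡ true → C A) × (d A ≡ false → C (¬f A)))) →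
    ⊥
theorem3p12 C Code eval represent mp consistent decider =
  liar-undecided mp consistent G≃¬G (decider⇒complete C decider G)
  where
    liar : Σ Form (λ G → G ≃[ C ] (¬f G))
    liar = diagonal-lemma C Code eval represent ¬f_

    G : Form
    G = proj₁ liar

    G≃¬G : G ≃[ C ] (¬f G)
    G≃¬G = proj₂ liar
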